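{- Let $t\ge 2$ and let $a\ge d\ge 0$ be integers with $a\ge 1$. Then ${\rm forb}(m,t\cdot F_{a,0,0,d})$ is $\Theta(m^a)$ as $m\to\infty$.
   Context: A matrix is simple if it is a (0,1)-matrix with no repeated columns. For (0,1)-matrices $F$ and $A$, $F\prec A$ means some row and column permutation of $F$ is a submatrix of $A$. ${\rm forb}(m,F)$ is the maximum number of columns of an $m$-rowed simple matrix $A$ with $F\not\prec A$ ($F$ need not be simple). $t\cdot M$ denotes the concatenation of $t$ copies of the matrix $M$. $F_{e,f,g,h}$ denotes the $(e+f+g+h)\times 2$ (0,1)-matrix with $e$ rows $[1\,1]$, $f$ rows $[1\,0]$, $g$ rows $[0\,1]$ and $h$ rows $[0\,0]$. -}

module Defs where

open import Data.Bool using (Bool; true; false; if_then_else_)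
open import Data.Nat using (ℕ; _+_; _*_; _^_; _≤_; _<ᵇ_)
open import Data.Fin using (Fin; toℕ; remainder)
open import Data.Product using (Σ; _×_; ∃)
open import Function.Definitions using (Injective)
open import Relation.Binary.PropositionalEquality using (_≡_)
open import Relation.Nullary using (¬_)

-- An m × n (0,1)-matrix: entry (row r, column c); true = 1, false = 0.
Matrix : ℕ → ℕ → Set
Matrix m n = Fin m → Fin n → Bool

Simple : ∀ {m n} → Matrix m n → Set
Simple {m} {n} A = ∀ (i j : Fin n) → (∀ (r : Fin m) → A r i ≡ A r j) → i ≡ j

-- F ≺ A: some row and column permutation of F is a submatrix of A,
-- i.e. there are injective row and column maps embedding F into A.
_≺_ : ∀ {k l m n} → Matrix k l → Matrix m n → Set
_≺_ {k} {l} {m} {n} F A =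
  Σ (Fin k → Fin m) λ ρ → Σ (Fin l → Fin n) λ γ →
    Injective _≡_ _≡_ ρ × Injective _≡_ _≡_ γ ×
    (∀ (r : Fin k) (c : Fin l) → F r c ≡ A (ρ r) (γ c))

-- t · M : concatenation of t copies of M (column index in copy q, column c
-- is q * l + c, as given by Data.Fin.remQuot).
_·_ : ∀ {k l} (t : ℕ) → Matrix k l → Matrix k (t * l)
_·_ {k} {l} t M r c = M r (remainder {t} l c)

-- F_{e,f,g,h}: e rows [1 1], f rows [1 0], g rows [0 1], h rows [0 0].
F[_,_,_,_] : (e f g h : ℕ) → Matrix (e + f + g + h) 2
F[ e , f , g , h ] r c =
  if toℕ r <ᵇ e then true
  else if toℕ r <ᵇ e + f then (toℕ c <ᵇ 1)
  else if toℕ r <ᵇ e + f + g then (0 <ᵇ toℕ c)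
  else false

-- n is the number of columns of an m-rowed simple matrix avoiding F
-- (the set over which forb(m,F) is the maximum).
Avoider : ∀ {k l} (m : ℕ) → Matrix k l → ℕ → Set
Avoider m F n = Σ (Matrix m n) λ A → Simple A × ¬ (F ≺ A)

ForbAtMost : ∀ {k l} (m : ℕ) → Matrix k l → ℕ → Set
ForbAtMost m F b = ∀ n → Avoider m F n → n ≤ b

ForbAtLeast : ∀ {k l} (m : ℕ) → Matrix k l → ℕ → Set
ForbAtLeast m F b = ∃ λ n → Avoider m F n × b ≤ n

-- forb(m,F) is Θ(m^a): there are constants c₁ = 1/k₁ > 0, c₂ > 0 and M with
-- c₁ m^a ≤ forb(m,F) ≤ c₂ m^a for all m ≥ M.
ForbTheta : ∀ {k l} → Matrix k l → ℕ → Set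
ForbTheta F a =
  Σ ℕ λ k₁ → Σ ℕ λ c₂ → Σ ℕ λ M → ∀ m → M ≤ m →
    (Σ ℕ λ b → ForbAtLeast m F b × m ^ a ≤ k₁ * b) × ForbAtMost m F (c₂ * m ^ a)

-- t · F_{a,0,0,d} consists of 2t equal columns, so a matrix contains it iff some 2t of its
-- columns agree on a rows of 1s and d rows of 0s.  Upper bound: splitting the columns by their
-- first entry, a family without p such columns splits into one without p such columns for
-- (a - 1, d) (for (0, d) when a = 0) and one for (a, d - 1); induction gives at most
-- p ((m+1)^a + (m+1)^d) - p columns, which is O(m^a) as d ≤ a.  Lower bound: the (m/a)^a columns
-- having a single 1 in each of a blocks of m/a rows have weight a, and two distinct columns of
-- weight at most a cannot both be 1 on the same a rows.
module Submission where

open import Defs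
open import Data.Bool using (Bool; true; false)
open import Data.Bool.Properties using (T-≡; _≟_)
open import Data.Empty using (⊥-elim)
open import Data.Fin as Fin using (Fin; zero; suc; toℕ; cast; splitAt; join; _↑ˡ_; _↑ʳ_; remQuot; combine; lift)
open import Data.Fin.Properties
  using (suc-injective; 0≢1+n; toℕ<n; toℕ-cast; toℕ-↑ˡ; toℕ-↑ʳ; cast-involutive; splitAt-join; join-splitAt;
         combine-remQuot; lift-injective)
open import Data.Fin.Subset as Subset using (Subset; ∣_∣; _⊆_; _∩_; _-_; ⁅_⁆; inside; outside)
open import Data.Fin.Subset.Properties
  using (drop-∷-⊆; p⊆q⇒∣p∣≤∣q∣; ∣⊥∣≡0; x∈⁅x⁆; x∈⁅y⁆⇒x≡y; ∣⁅x⁆∣≡1; p∩q⊆p; p∩q⊆q; x∈p∩q⁺;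
         x∈p∧x≢y⇒x∈p-y; x∈p⇒∣p-x∣<∣p∣)
open import Data.List as List using (List; []; _∷_; length)
open import Data.List.Properties using (length-tabulate)
open import Data.List.Membership.Propositional using (_∈_)
open import Data.List.Membership.Propositional.Properties using (∈-tabulate⁻)
open import Data.List.Relation.Unary.All as All using (All)
open import Data.List.Relation.Unary.AllPairs using ([]; _∷_)
open import Data.List.Relation.Unary.Any using (here; there)
open import Data.List.Relation.Unary.Unique.Propositional using (Unique)
open import Data.List.Relation.Unary.Unique.Propositional.Properties using (tabulate⁺)
open import Data.Nat
  using (ℕ; zero; suc; pred; _+_; _*_; _^_; _≤_; _<_; _<ᵇ_; z≤n; s≤s; z<s; NonZero; >-nonZero; _/_; _%_)
open import Data.Nat.Properties hiding (0≢1+n; suc-injective; _≟_)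
open import Data.Nat.DivMod using (m/n*n≤m; m≥n⇒m/n>0; m≡m%n+[m/n]*n; m%n<n)
open import Data.Nat.Tactic.RingSolver using (solve-∀)
open import Data.Product using (Σ; _×_; _,_; proj₁; proj₂; uncurry)
open import Data.Sum using (_⊎_; inj₁; inj₂; [_,_]′)
open import Data.Sum.Properties using (inj₁-injective)
open import Data.Vec using (Vec; []; _∷_; lookup; tabulate; _++_)
open import Data.Vec.Properties
  using (∷-injectiveˡ; ∷-injectiveʳ; ++-injective; lookup∘tabulate; tabulate∘lookup; tabulate-cong; lookup⇒[]=)
open import Data.Vec.Functional as Functional using ()
open import Function using (_∘_; const)
open import Function.Bundles using (Equivalence)
open import Function.Definitions using (Injective)
open import Algebra.Properties.CommutativeSemigroup +-commutativeSemigroup using (interchange)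
open import Relation.Binary.PropositionalEquality
open import Relation.Nullary using (¬_; contradiction; yes; no)

private
  variable
    k m n p a d t : ℕ

left-inverse⇒injective : ∀ {A B : Set} (f : A → B) (g : B → A) → (∀ x → g (f x) ≡ x) → Injective _≡_ _≡_ f
left-inverse⇒injective f g gf {x} {y} e = trans (sym (gf x)) (trans (cong g e) (gf y))

∣p++q∣≡∣p∣+∣q∣ : ∀ {k l} (p : Subset k) (q : Subset l) → ∣ p ++ q ∣ ≡ ∣ p ∣ + ∣ q ∣
∣p++q∣≡∣p∣+∣q∣ [] q = refl
∣p++q∣≡∣p∣+∣q∣ (inside ∷ p) q = cong suc (∣p++q∣≡∣p∣+∣q∣ p q)
∣p++q∣≡∣p∣+∣q∣ (outside ∷ p) q = ∣p++q∣≡∣p∣+∣q∣ p q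

⁅⁆-injective : Injective _≡_ _≡_ (⁅_⁆ {n})
⁅⁆-injective {x = x} {y} e = x∈⁅y⁆⇒x≡y y (subst (x Subset.∈_) e (x∈⁅x⁆ x))

injective⇒≤∣p∣ : {P : Subset m} (f : Fin k → Fin m) → Injective _≡_ _≡_ f → (∀ i → f i Subset.∈ P) → k ≤ ∣ P ∣
injective⇒≤∣p∣ {k = zero} f _ _ = z≤n
injective⇒≤∣p∣ {k = suc k} f f-inj f∈P =
  ≤-<-trans (injective⇒≤∣p∣ (f ∘ suc) (suc-injective ∘ f-inj) f∘suc∈P-f₀) (x∈p⇒∣p-x∣<∣p∣ (f∈P zero))
  where
  f∘suc∈P-f₀ : ∀ i → f (suc i) Subset.∈ _ - f zero
  f∘suc∈P-f₀ i = x∈p∧x≢y⇒x∈p-y (f∈P (suc i)) (λ e → 0≢1+n (sym (f-inj e)))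

p⊆q∧∣q∣≤∣p∣⇒p≡q : {P Q : Subset n} → P ⊆ Q → ∣ Q ∣ ≤ ∣ P ∣ → P ≡ Q
p⊆q∧∣q∣≤∣p∣⇒p≡q {P = []} {[]} _ _ = refl
p⊆q∧∣q∣≤∣p∣⇒p≡q {P = outside ∷ P} {outside ∷ Q} P⊆Q le = cong (outside ∷_) (p⊆q∧∣q∣≤∣p∣⇒p≡q (drop-∷-⊆ P⊆Q) le)
p⊆q∧∣q∣≤∣p∣⇒p≡q {P = inside ∷ P} {inside ∷ Q} P⊆Q le = cong (inside ∷_) (p⊆q∧∣q∣≤∣p∣⇒p≡q (drop-∷-⊆ P⊆Q) (≤-pred le))
p⊆q∧∣q∣≤∣p∣⇒p≡q {P = inside ∷ P} {outside ∷ Q} P⊆Q _ = contradiction (P⊆Q Data.Vec.here) λ ()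
p⊆q∧∣q∣≤∣p∣⇒p≡q {P = outside ∷ P} {inside ∷ Q} P⊆Q le = contradiction (≤-trans le (p⊆q⇒∣p∣≤∣q∣ (drop-∷-⊆ P⊆Q))) 1+n≰n

common-image⇒≡ : {P Q : Subset m} (f : Fin k → Fin m) → Injective _≡_ _≡_ f →
                 (∀ i → f i Subset.∈ P) → (∀ i → f i Subset.∈ Q) → ∣ P ∣ ≤ k → ∣ Q ∣ ≤ k → P ≡ Q
common-image⇒≡ {P = P} {Q} f f-inj f∈P f∈Q ∣P∣≤k ∣Q∣≤k = trans (sym P∩Q≡P) P∩Q≡Q
  where
  k≤∣P∩Q∣ : _ ≤ ∣ P ∩ Q ∣
  k≤∣P∩Q∣ = injective⇒≤∣p∣ f f-inj (λ i → x∈p∩q⁺ (f∈P i , f∈Q i))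
  P∩Q≡P : P ∩ Q ≡ P
  P∩Q≡P = p⊆q∧∣q∣≤∣p∣⇒p≡q (p∩q⊆p P Q) (≤-trans ∣P∣≤k k≤∣P∩Q∣)
  P∩Q≡Q : P ∩ Q ≡ Q
  P∩Q≡Q = p⊆q∧∣q∣≤∣p∣⇒p≡q (p∩q⊆q P Q) (≤-trans ∣Q∣≤k k≤∣P∩Q∣)

col : Matrix m n → Fin n → Vec Bool m
col A c = tabulate (λ r → A r c)

col-injective : (A : Matrix m n) → Simple A → Injective _≡_ _≡_ (col A)
col-injective A simple {c} {c′} e = simple c c′ λ r →
  trans (sym (lookup∘tabulate _ r)) (trans (cong (λ v → lookup v r) e) (lookup∘tabulate _ r))

columns : Matrix m n → List (Vec Bool m)
columns A = List.tabulate (col A)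

fromColumns : (Fin n → Vec Bool m) → Matrix m n
fromColumns v r c = lookup (v c) r

fromColumns-simple : (v : Fin n → Vec Bool m) → Injective _≡_ _≡_ v → Simple (fromColumns v)
fromColumns-simple v v-inj c c′ same =
  v-inj (trans (sym (tabulate∘lookup (v c))) (trans (tabulate-cong same) (tabulate∘lookup (v c′))))

isOneRow : Fin a ⊎ Fin d → Bool
isOneRow = [ const true , const false ]′

m+n<ᵇm≡false : ∀ m n → (m + n <ᵇ m) ≡ false
m+n<ᵇm≡false zero n = refl
m+n<ᵇm≡false (suc m) n = m+n<ᵇm≡false m n

F-entry : ∀ a d (r : Fin (a + 0 + 0 + d)) c → F[ a , 0 , 0 , d ] r c ≡ (toℕ r <ᵇ a)
F-entry a d r c with toℕ r <ᵇ a in eq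
... | true = refl
... | false rewrite +-identityʳ a | +-identityʳ a | eq = refl

module _ (a d : ℕ) where

  private
    a+0+0+d≡a+d : a + 0 + 0 + d ≡ a + d
    a+0+0+d≡a+d = cong (_+ d) (trans (+-identityʳ (a + 0)) (+-identityʳ a))

  rowSplit : Fin (a + 0 + 0 + d) → Fin a ⊎ Fin d
  rowSplit r = splitAt a (cast a+0+0+d≡a+d r)

  rowJoin : Fin a ⊎ Fin d → Fin (a + 0 + 0 + d)
  rowJoin x = cast (sym a+0+0+d≡a+d) (join a d x)

  rowSplit-rowJoin : ∀ x → rowSplit (rowJoin x) ≡ x
  rowSplit-rowJoin x =
    trans (cong (splitAt a) (cast-involutive a+0+0+d≡a+d (sym a+0+0+d≡a+d) _)) (splitAt-join a d x)

  rowJoin-rowSplit : ∀ r → rowJoin (rowSplit r) ≡ r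
  rowJoin-rowSplit r =
    trans (cong (cast _) (join-splitAt a d _)) (cast-involutive (sym a+0+0+d≡a+d) a+0+0+d≡a+d r)

  F-rowJoin : ∀ x c → F[ a , 0 , 0 , d ] (rowJoin x) c ≡ isOneRow x
  F-rowJoin x c = trans (F-entry a d (rowJoin x) c) (<ᵇ-rowJoin x)
    where
    <ᵇ-rowJoin : ∀ x → (toℕ (rowJoin x) <ᵇ a) ≡ isOneRow x
    <ᵇ-rowJoin (inj₁ i) = trans (cong (_<ᵇ a) (trans (toℕ-cast _ (i ↑ˡ d)) (toℕ-↑ˡ i d)))
                                (Equivalence.to T-≡ (<⇒<ᵇ (toℕ<n i)))
    <ᵇ-rowJoin (inj₂ j) = trans (cong (_<ᵇ a) (trans (toℕ-cast _ (a ↑ʳ j)) (toℕ-↑ʳ a j)))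
                                (m+n<ᵇm≡false a (toℕ j))

-- Columns agreeing on a rows of 1s and d rows of 0s

record RowPattern (m a d : ℕ) : Set where
  field
    oneRow : Fin a → Fin m
    zeroRow : Fin d → Fin m
    oneRow-injective : Injective _≡_ _≡_ oneRow
    zeroRow-injective : Injective _≡_ _≡_ zeroRow
    disjoint : ∀ i j → oneRow i ≢ zeroRow j

  row : Fin a ⊎ Fin d → Fin m
  row = [ oneRow , zeroRow ]′

  row-injective : Injective _≡_ _≡_ row
  row-injective {inj₁ i} {inj₁ j} e = cong inj₁ (oneRow-injective e)
  row-injective {inj₁ i} {inj₂ j} e = ⊥-elim (disjoint i j e)
  row-injective {inj₂ i} {inj₁ j} e = ⊥-elim (disjoint j i (sym e))
  row-injective {inj₂ i} {inj₂ j} e = cong inj₂ (zeroRow-injective e)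

open RowPattern

Matches : RowPattern m a d → Vec Bool m → Set
Matches R v = (∀ i → lookup v (oneRow R i) ≡ true) × (∀ j → lookup v (zeroRow R j) ≡ false)

lookup-row : (R : RowPattern m a d) {v : Vec Bool m} → Matches R v → ∀ x → lookup v (row R x) ≡ isOneRow x
lookup-row R (ones , _) (inj₁ i) = ones i
lookup-row R (_ , zeros) (inj₂ j) = zeros j

noRows : RowPattern m 0 0
noRows = record
  { oneRow = λ () ; zeroRow = λ () ; oneRow-injective = λ { {()} } ; zeroRow-injective = λ { {()} } ; disjoint = λ () }

skipFirstRow : RowPattern m a d → RowPattern (suc m) a d
skipFirstRow R = record
  { oneRow = suc ∘ oneRow R
  ; zeroRow = suc ∘ zeroRow R
  ; oneRow-injective = oneRow-injective R ∘ suc-injective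
  ; zeroRow-injective = zeroRow-injective R ∘ suc-injective
  ; disjoint = λ i j → disjoint R i j ∘ suc-injective
  }

firstRowOne : RowPattern m a d → RowPattern (suc m) (suc a) d
firstRowOne R = record
  { oneRow = lift 1 (oneRow R)
  ; zeroRow = suc ∘ zeroRow R
  ; oneRow-injective = lift-injective (oneRow R) (oneRow-injective R) 1
  ; zeroRow-injective = zeroRow-injective R ∘ suc-injective
  ; disjoint = disjoint′
  }
  where
  disjoint′ : ∀ i j → lift 1 (oneRow R) i ≢ suc (zeroRow R j)
  disjoint′ (suc i) j = disjoint R i j ∘ suc-injective

firstRowZero : RowPattern m a d → RowPattern (suc m) a (suc d)
firstRowZero R = record
  { oneRow = suc ∘ oneRow R
  ; zeroRow = lift 1 (zeroRow R)
  ; oneRow-injective = oneRow-injective R ∘ suc-injective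
  ; zeroRow-injective = lift-injective (zeroRow R) (zeroRow-injective R) 1
  ; disjoint = disjoint′
  }
  where
  disjoint′ : ∀ i j → suc (oneRow R i) ≢ lift 1 (zeroRow R) j
  disjoint′ i (suc j) = disjoint R i j ∘ suc-injective

Matches-firstRowOne : (R : RowPattern m a d) {v : Vec Bool m} → Matches R v → Matches (firstRowOne R) (true ∷ v)
Matches-firstRowOne R (ones , zeros) = ones′ , zeros
  where
  ones′ : ∀ i → lookup (true ∷ _) (lift 1 (oneRow R) i) ≡ true
  ones′ zero = refl
  ones′ (suc i) = ones i

Matches-firstRowZero : (R : RowPattern m a d) {v : Vec Bool m} → Matches R v → Matches (firstRowZero R) (false ∷ v)
Matches-firstRowZero R (ones , zeros) = ones , zeros′
  where
  zeros′ : ∀ j → lookup (false ∷ _) (lift 1 (zeroRow R) j) ≡ false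
  zeros′ zero = refl
  zeros′ (suc j) = zeros j

Distinct : {A : Set} → ℕ → (A → Set) → List A → Set
Distinct {A} p P S = Σ (Fin p → A) λ τ → Injective _≡_ _≡_ τ × (∀ k → τ k ∈ S × P (τ k))

Distinct-map : {A B : Set} {P : A → Set} {Q : B → Set} {S : List A} {S′ : List B} (f : A → B) →
               Injective _≡_ _≡_ f → (∀ {x} → x ∈ S → f x ∈ S′) → (∀ {x} → P x → Q (f x)) →
               Distinct p P S → Distinct p Q S′
Distinct-map f f-inj ∈S′ PQ (τ , τ-inj , τ-ok) =
  f ∘ τ , τ-inj ∘ f-inj , λ k → ∈S′ (proj₁ (τ-ok k)) , PQ (proj₂ (τ-ok k))

Unique⇒Distinct : {A : Set} {P : A → Set} {S : List A} → (∀ x → P x) → Unique S → p ≤ length S → Distinct p P S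
Unique⇒Distinct {p = zero} _ _ _ = (λ ()) , (λ { {()} }) , λ ()
Unique⇒Distinct {p = suc p} {S = x ∷ S} P-all (x∉S ∷ unique) (s≤s p≤∣S∣)
  with τ , τ-inj , τ-ok ← Unique⇒Distinct P-all unique p≤∣S∣ = x Functional.∷ τ , inj , ok
  where
  inj : Injective _≡_ _≡_ (x Functional.∷ τ)
  inj {zero} {zero} _ = refl
  inj {zero} {suc j} e = contradiction e (All.lookup x∉S (proj₁ (τ-ok j)))
  inj {suc i} {zero} e = contradiction (sym e) (All.lookup x∉S (proj₁ (τ-ok i)))
  inj {suc i} {suc j} e = cong suc (τ-inj e)
  ok : ∀ k → (x Functional.∷ τ) k ∈ x ∷ S × _
  ok zero = here refl , P-all x
  ok (suc k) = there (proj₁ (τ-ok k)) , proj₂ (τ-ok k)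

Unique-length≤1 : (S : List (Vec Bool 0)) → Unique S → length S ≤ 1
Unique-length≤1 [] _ = z≤n
Unique-length≤1 ([] ∷ []) _ = s≤s z≤n
Unique-length≤1 ([] ∷ [] ∷ _) ((≢[] All.∷ _) ∷ _) = contradiction refl ≢[]

Contains : ℕ → (a d : ℕ) → List (Vec Bool m) → Set
Contains {m} p a d S = Σ (RowPattern m a d) λ R → Distinct p (Matches R) S

withHead : Bool → List (Vec Bool (suc m)) → List (Vec Bool m)
withHead b [] = []
withHead b ((c ∷ v) ∷ S) with c ≟ b
... | yes _ = v ∷ withHead b S
... | no _ = withHead b S

length-withHead : (S : List (Vec Bool (suc m))) → length S ≡ length (withHead true S) + length (withHead false S)
length-withHead [] = refl
length-withHead ((true ∷ v) ∷ S) = cong suc (length-withHead S)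
length-withHead ((false ∷ v) ∷ S) = trans (cong suc (length-withHead S)) (sym (+-suc _ _))

∈-withHead : ∀ {b} {v : Vec Bool m} (S : List (Vec Bool (suc m))) → v ∈ withHead b S → (b ∷ v) ∈ S
∈-withHead {b = b} ((c ∷ w) ∷ S) v∈ with c ≟ b
∈-withHead ((c ∷ w) ∷ S) (here refl) | yes refl = here refl
∈-withHead ((c ∷ w) ∷ S) (there v∈) | yes refl = there (∈-withHead S v∈)
∈-withHead ((c ∷ w) ∷ S) v∈ | no _ = there (∈-withHead S v∈)

Unique-withHead : ∀ {b} (S : List (Vec Bool (suc m))) → Unique S → Unique (withHead b S)
Unique-withHead [] _ = []
Unique-withHead {b = b} ((c ∷ w) ∷ S) (w∉S ∷ unique) with c ≟ b
... | yes refl = All.tabulate (λ v∈ e → All.lookup w∉S (∈-withHead S v∈) (cong (c ∷_) e)) ∷ Unique-withHead S unique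
... | no _ = Unique-withHead S unique

Contains-lift : ∀ {a′ d′ b} (S : List (Vec Bool (suc m))) (f : RowPattern m a′ d′ → RowPattern (suc m) a d) →
                (∀ R {v} → Matches R v → Matches (f R) (b ∷ v)) →
                Contains p a′ d′ (withHead b S) → Contains p a d S
Contains-lift S f fits (R , τs) =
  f R , Distinct-map {Q = Matches (f R)} (_ ∷_) ∷-injectiveʳ (∈-withHead S) (fits R) τs

Contains-headOne : (S : List (Vec Bool (suc m))) → Contains p (pred a) d (withHead true S) → Contains p a d S
Contains-headOne {a = zero} S = Contains-lift S skipFirstRow λ _ fits → fits
Contains-headOne {a = suc a} S = Contains-lift S firstRowOne Matches-firstRowOne

Contains-headZero : (S : List (Vec Bool (suc m))) → Contains p a (pred d) (withHead false S) → Contains p a d S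
Contains-headZero {d = zero} S = Contains-lift S skipFirstRow λ _ fits → fits
Contains-headZero {d = suc d} S = Contains-lift S firstRowZero Matches-firstRowZero

-- Counting columns

Budget : ℕ → ℕ → ℕ → ℕ
Budget m a d = suc m ^ a + suc m ^ d

^-distribʳ-* : ∀ m n k → (m * n) ^ k ≡ m ^ k * n ^ k
^-distribʳ-* m n zero = refl
^-distribʳ-* m n (suc k) = trans (cong (m * n *_) (^-distribʳ-* m n k)) (*-interchange m n (m ^ k) (n ^ k))
  where
  *-interchange : ∀ w x y z → (w * x) * (y * z) ≡ (w * y) * (x * z)
  *-interchange = solve-∀

pow-step : ∀ m k → suc m ^ k + suc m ^ suc k ≤ suc (suc m) ^ suc k
pow-step m k = *-monoʳ-≤ (suc (suc m)) (^-monoˡ-≤ k (n≤1+n (suc m)))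

module _ (m : ℕ) where

  private
    W : ℕ → ℕ
    W = suc m ^_

  Budget-split : ∀ a d → 0 < a + d → Budget m (pred a) d + Budget m a (pred d) ≤ Budget (suc m) a d + 1
  Budget-split (suc a) (suc d) _ = begin
    (W a + W (suc d)) + (W (suc a) + W d) ≡⟨ interchange (W a) _ _ _ ⟩
    (W a + W (suc a)) + (W (suc d) + W d) ≤⟨ +-mono-≤ (pow-step m a)
                                                (≤-trans (≤-reflexive (+-comm (W (suc d)) (W d))) (pow-step m d)) ⟩
    Budget (suc m) (suc a) (suc d)        ≤⟨ m≤m+n _ 1 ⟩
    Budget (suc m) (suc a) (suc d) + 1    ∎
    where open ≤-Reasoning
  Budget-split (suc a) zero _ = begin
    (W a + 1) + (W (suc a) + 1) ≡⟨ interchange (W a) _ _ _ ⟩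
    (W a + W (suc a)) + 2       ≤⟨ +-monoˡ-≤ 2 (pow-step m a) ⟩
    suc (suc m) ^ suc a + 2     ≡⟨ sym (+-assoc _ 1 1) ⟩
    Budget (suc m) (suc a) 0 + 1 ∎
    where open ≤-Reasoning
  Budget-split zero (suc d) _ = begin
    (1 + W (suc d)) + (1 + W d) ≡⟨ interchange 1 (W (suc d)) 1 (W d) ⟩
    2 + (W (suc d) + W d)       ≤⟨ +-monoʳ-≤ 2 (≤-trans (≤-reflexive (+-comm (W (suc d)) (W d))) (pow-step m d)) ⟩
    2 + suc (suc m) ^ suc d     ≡⟨ +-comm 1 (Budget (suc m) 0 (suc d)) ⟩
    Budget (suc m) 0 (suc d) + 1 ∎
    where open ≤-Reasoning

few-columns-bound : ∀ m a d {ℓ} → ℓ ≤ p → ℓ + p ≤ p * Budget m a d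
few-columns-bound {p} m a d {ℓ} ℓ≤p = begin
  ℓ + p               ≤⟨ +-monoˡ-≤ p ℓ≤p ⟩
  p + p               ≡⟨ trans (cong (p +_) (sym (+-identityʳ p))) (*-comm 2 p) ⟩
  p * 2               ≤⟨ *-monoʳ-≤ p (+-mono-≤ (m^n>0 (suc m) a) (m^n>0 (suc m) d)) ⟩
  p * Budget m a d    ∎
  where open ≤-Reasoning

halves-bound : ∀ p {ℓ₁ ℓ₀ y₁ y₀ y} → ℓ₁ + p ≤ p * y₁ → ℓ₀ + p ≤ p * y₀ → y₁ + y₀ ≤ y + 1 → (ℓ₁ + ℓ₀) + p ≤ p * y
halves-bound p {ℓ₁} {ℓ₀} {y₁} {y₀} {y} h₁ h₀ h = +-cancelʳ-≤ p _ _ (begin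
  (ℓ₁ + ℓ₀) + p + p   ≡⟨ +-assoc (ℓ₁ + ℓ₀) p p ⟩
  (ℓ₁ + ℓ₀) + (p + p) ≡⟨ interchange ℓ₁ ℓ₀ p p ⟩
  (ℓ₁ + p) + (ℓ₀ + p) ≤⟨ +-mono-≤ h₁ h₀ ⟩
  p * y₁ + p * y₀     ≡⟨ sym (*-distribˡ-+ p y₁ y₀) ⟩
  p * (y₁ + y₀)       ≤⟨ *-monoʳ-≤ p h ⟩
  p * (y + 1)         ≡⟨ trans (*-distribˡ-+ p y 1) (cong (p * y +_) (*-identityʳ p)) ⟩
  p * y + p           ∎)
  where open ≤-Reasoning

-- The summand p on the left absorbs the + 1 of Budget-split.
column-bound : 1 ≤ p → ∀ m a d (S : List (Vec Bool m)) → Unique S → ¬ Contains p a d S →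
               length S + p ≤ p * Budget m a d
column-split : 1 ≤ p → ∀ m a d (S : List (Vec Bool (suc m))) → Unique S → ¬ Contains p a d S → 0 < a + d →
               length S + p ≤ p * Budget (suc m) a d

column-bound {p} _ m zero zero S unique ¬C = few-columns-bound m 0 0 (<⇒≤ (≰⇒> p≰∣S∣))
  where
  p≰∣S∣ : ¬ p ≤ length S
  p≰∣S∣ p≤∣S∣ = ¬C (noRows , Unique⇒Distinct {P = Matches noRows} (λ _ → (λ ()) , (λ ())) unique p≤∣S∣)
column-bound 1≤p zero (suc a) d S unique _ = few-columns-bound 0 (suc a) d (≤-trans (Unique-length≤1 S unique) 1≤p)
column-bound 1≤p zero zero (suc d) S unique _ = few-columns-bound 0 0 (suc d) (≤-trans (Unique-length≤1 S unique) 1≤p)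
column-bound 1≤p (suc m) (suc a) d S unique ¬C = column-split 1≤p m (suc a) d S unique ¬C z<s
column-bound 1≤p (suc m) zero (suc d) S unique ¬C = column-split 1≤p m 0 (suc d) S unique ¬C z<s

column-split {p} 1≤p m a d S unique ¬C 0<a+d =
  subst (λ ℓ → ℓ + p ≤ p * Budget (suc m) a d) (sym (length-withHead S))
    (halves-bound p
      (column-bound 1≤p m (pred a) d (withHead true S) (Unique-withHead S unique) (¬C ∘ Contains-headOne S))
      (column-bound 1≤p m a (pred d) (withHead false S) (Unique-withHead S unique) (¬C ∘ Contains-headZero S))
      (Budget-split m a d 0<a+d))

Contains⇒≺ : (A : Matrix m n) → Contains (t * 2) a d (columns A) → (t · F[ a , 0 , 0 , d ]) ≺ A
Contains⇒≺ {t = t} {a} {d} A (R , τ , τ-inj , τ-ok) = ρ , γ , ρ-inj , γ-inj , entry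
  where
  ρ : Fin (a + 0 + 0 + d) → Fin _
  ρ = row R ∘ rowSplit a d
  ρ-inj : Injective _≡_ _≡_ ρ
  ρ-inj = left-inverse⇒injective (rowSplit a d) (rowJoin a d) (rowJoin-rowSplit a d) ∘ row-injective R
  γ : Fin (t * 2) → Fin _
  γ c = proj₁ (∈-tabulate⁻ (proj₁ (τ-ok c)))
  τ≡col : ∀ c → τ c ≡ col A (γ c)
  τ≡col c = proj₂ (∈-tabulate⁻ (proj₁ (τ-ok c)))
  γ-inj : Injective _≡_ _≡_ γ
  γ-inj {c} {c′} e = τ-inj (trans (τ≡col c) (trans (cong (col A) e) (sym (τ≡col c′))))
  entry : ∀ r c → (t · F[ a , 0 , 0 , d ]) r c ≡ A (ρ r) (γ c)
  entry r c = begin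
    F[ a , 0 , 0 , d ] r c′                          ≡⟨ cong (λ r → F[ a , 0 , 0 , d ] r c′)
                                                           (sym (rowJoin-rowSplit a d r)) ⟩
    F[ a , 0 , 0 , d ] (rowJoin a d (rowSplit a d r)) c′ ≡⟨ F-rowJoin a d (rowSplit a d r) c′ ⟩
    isOneRow (rowSplit a d r)                        ≡⟨ sym (lookup-row R {τ c} (proj₂ (τ-ok c)) (rowSplit a d r)) ⟩
    lookup (τ c) (ρ r)                               ≡⟨ cong (λ v → lookup v (ρ r)) (τ≡col c) ⟩
    lookup (col A (γ c)) (ρ r)                       ≡⟨ lookup∘tabulate _ (ρ r) ⟩
    A (ρ r) (γ c)                                    ∎
    where
    open ≡-Reasoning
    c′ : Fin 2
    c′ = Fin.remainder {t} 2 c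

Avoider-size-bound : 1 ≤ t → Avoider m (t · F[ a , 0 , 0 , d ]) n → n + t * 2 ≤ t * 2 * Budget m a d
Avoider-size-bound {t} {m} {a} {d} 1≤t (A , simple , avoids) =
  subst (λ ℓ → ℓ + t * 2 ≤ t * 2 * Budget m a d) (length-tabulate (col A))
    (column-bound (≤-trans (s≤s z≤n) (*-monoˡ-≤ 2 1≤t)) m a d (columns A) (tabulate⁺ (col-injective A simple))
                  (avoids ∘ Contains⇒≺ {t = t} A))

forb-upper : 1 ≤ t → 1 ≤ m → d ≤ a → ForbAtMost m (t · F[ a , 0 , 0 , d ]) (t * 2 * 2 ^ suc a * m ^ a)
forb-upper {t} {m} {d} {a} 1≤t 1≤m d≤a n avoider = begin
  n                              ≤⟨ m≤m+n n (t * 2) ⟩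
  n + t * 2                      ≤⟨ Avoider-size-bound {t} {m} {a} {d} 1≤t avoider ⟩
  t * 2 * Budget m a d           ≤⟨ *-monoʳ-≤ (t * 2) Budget≤ ⟩
  t * 2 * (2 ^ suc a * m ^ a)    ≡⟨ sym (*-assoc (t * 2) _ _) ⟩
  t * 2 * 2 ^ suc a * m ^ a      ∎
  where
  open ≤-Reasoning
  Budget≤ : Budget m a d ≤ 2 ^ suc a * m ^ a
  Budget≤ = begin
    suc m ^ a + suc m ^ d     ≤⟨ +-monoʳ-≤ (suc m ^ a) (^-monoʳ-≤ (suc m) d≤a) ⟩
    suc m ^ a + suc m ^ a     ≡⟨ cong (suc m ^ a +_) (sym (+-identityʳ _)) ⟩
    2 * suc m ^ a             ≤⟨ *-monoʳ-≤ 2 (^-monoˡ-≤ a (+-monoˡ-≤ m 1≤m)) ⟩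
    2 * (m + m) ^ a           ≡⟨ cong (λ x → 2 * (m + x) ^ a) (sym (+-identityʳ m)) ⟩
    2 * (2 * m) ^ a           ≡⟨ cong (2 *_) (^-distribʳ-* 2 m a) ⟩
    2 * (2 ^ a * m ^ a)       ≡⟨ sym (*-assoc 2 (2 ^ a) (m ^ a)) ⟩
    2 ^ suc a * m ^ a         ∎

-- The block matrix

blockColumn : ∀ q a → Fin (q ^ a) → Subset (a * q)
blockColumn q zero _ = []
blockColumn q (suc a) c = ⁅ proj₁ (remQuot (q ^ a) c) ⁆ ++ blockColumn q a (proj₂ (remQuot {q} (q ^ a) c))

∣blockColumn∣ : ∀ q a c → ∣ blockColumn q a c ∣ ≡ a
∣blockColumn∣ q zero c = refl
∣blockColumn∣ q (suc a) c = trans (∣p++q∣≡∣p∣+∣q∣ ⁅ i ⁆ _) (cong₂ _+_ (∣⁅x⁆∣≡1 i) (∣blockColumn∣ q a _))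
  where
  i : Fin q
  i = proj₁ (remQuot {q} (q ^ a) c)

blockColumn-injective : ∀ q a → Injective _≡_ _≡_ (blockColumn q a)
blockColumn-injective q zero {zero} {zero} _ = refl
blockColumn-injective q (suc a) {c} {c′} e with ++-injective ⁅ proj₁ (remQuot {q} (q ^ a) c) ⁆ _ e
... | heads , tails = left-inverse⇒injective (remQuot {q} (q ^ a)) (uncurry combine) (combine-remQuot {q} (q ^ a))
                        (cong₂ _,_ (⁅⁆-injective heads) (blockColumn-injective q a tails))

padOut : k ≤ m → Subset k → Subset m
padOut z≤n [] = Subset.⊥
padOut (s≤s k≤m) (x ∷ P) = x ∷ padOut k≤m P

∣padOut∣ : (k≤m : k ≤ m) (P : Subset k) → ∣ padOut k≤m P ∣ ≡ ∣ P ∣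
∣padOut∣ {m = m} z≤n [] = ∣⊥∣≡0 m
∣padOut∣ (s≤s k≤m) (inside ∷ P) = cong suc (∣padOut∣ k≤m P)
∣padOut∣ (s≤s k≤m) (outside ∷ P) = ∣padOut∣ k≤m P

padOut-injective : (k≤m : k ≤ m) → Injective _≡_ _≡_ (padOut k≤m)
padOut-injective z≤n {[]} {[]} _ = refl
padOut-injective (s≤s k≤m) {x ∷ P} {y ∷ Q} e = cong₂ _∷_ (∷-injectiveˡ e) (padOut-injective k≤m (∷-injectiveʳ e))

blockMatrix : ∀ q a → a * q ≤ m → Matrix m (q ^ a)
blockMatrix q a aq≤m = fromColumns (padOut aq≤m ∘ blockColumn q a)

-- The first two columns of an embedded t · F_{a,0,0,d} are distinct columns of A sharing a ones.
light-columns⇒avoids : (A : Matrix m n) → 1 ≤ t → Simple A → (∀ c → ∣ col A c ∣ ≤ a) → ¬ (t · F[ a , 0 , 0 , d ]) ≺ A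
light-columns⇒avoids {a = a} {d} A (s≤s {n = t} _) simple light (ρ , γ , ρ-inj , γ-inj , entry) =
  0≢1+n (γ-inj (col-injective A simple (common-image⇒≡ I I-inj (ones zero) (ones (suc zero)) (light _) (light _))))
  where
  I : Fin a → Fin _
  I i = ρ (rowJoin a d (inj₁ i))
  I-inj : Injective _≡_ _≡_ I
  I-inj = inj₁-injective ∘ left-inverse⇒injective (rowJoin a d) (rowSplit a d) (rowSplit-rowJoin a d) ∘ ρ-inj
  ones : ∀ c i → I i Subset.∈ col A (γ c)
  ones c i = lookup⇒[]= (I i) _ (begin
    lookup (col A (γ c)) (I i)                              ≡⟨ lookup∘tabulate _ (I i) ⟩
    A (I i) (γ c)                                           ≡⟨ sym (entry _ c) ⟩
    F[ a , 0 , 0 , d ] (rowJoin a d (inj₁ i)) c′            ≡⟨ F-rowJoin a d (inj₁ i) c′ ⟩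
    true                                                    ∎)
    where
    open ≡-Reasoning
    c′ : Fin 2
    c′ = Fin.remainder {suc t} 2 c

blockMatrix-avoids : ∀ q (aq≤m : a * q ≤ m) → 1 ≤ t → Avoider m (t · F[ a , 0 , 0 , d ]) (q ^ a)
blockMatrix-avoids {a} {d = d} q aq≤m 1≤t =
  A , A-simple , light-columns⇒avoids {d = d} A 1≤t A-simple λ c →
    ≤-reflexive (trans (cong ∣_∣ (tabulate∘lookup (padOut aq≤m (blockColumn q a c))))
                       (trans (∣padOut∣ aq≤m _) (∣blockColumn∣ q a c)))
  where
  A : Matrix _ (q ^ a)
  A = blockMatrix q a aq≤m
  A-simple : Simple A
  A-simple = fromColumns-simple _ (blockColumn-injective q a ∘ padOut-injective aq≤m)

forb-lower : 1 ≤ t → 1 ≤ a → a ≤ m → Σ ℕ λ b → ForbAtLeast m (t · F[ a , 0 , 0 , d ]) b × m ^ a ≤ (2 * a) ^ a * b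
forb-lower {t} {a} {m} {d} 1≤t 1≤a a≤m = q ^ a , (q ^ a , blockMatrix-avoids {d = d} q aq≤m 1≤t , ≤-refl) , m^a≤
  where
  instance
    a≢0 : NonZero a
    a≢0 = >-nonZero 1≤a
  q : ℕ
  q = m / a
  aq≤m : a * q ≤ m
  aq≤m = ≤-trans (≤-reflexive (*-comm a q)) (m/n*n≤m m a)
  a≤qa : a ≤ q * a
  a≤qa = ≤-trans (≤-reflexive (sym (*-identityˡ a))) (*-monoˡ-≤ a (m≥n⇒m/n>0 a≤m))
  m^a≤ : m ^ a ≤ (2 * a) ^ a * q ^ a
  m^a≤ = begin
    m ^ a                   ≡⟨ cong (_^ a) (m≡m%n+[m/n]*n m a) ⟩
    (m % a + q * a) ^ a     ≤⟨ ^-monoˡ-≤ a (+-monoˡ-≤ (q * a) (≤-trans (<⇒≤ (m%n<n m a)) a≤qa)) ⟩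
    (q * a + q * a) ^ a     ≡⟨ cong (_^ a) (double q a) ⟩
    (2 * a * q) ^ a         ≡⟨ ^-distribʳ-* (2 * a) q a ⟩
    (2 * a) ^ a * q ^ a     ∎
    where
    open ≤-Reasoning
    double : ∀ q a → q * a + q * a ≡ 2 * a * q
    double = solve-∀

theorem4 : (t a d : ℕ) → 2 ≤ t → d ≤ a → 1 ≤ a →
    ForbTheta (t · F[ a , 0 , 0 , d ]) a
theorem4 t a d 2≤t d≤a 1≤a =
  (2 * a) ^ a , t * 2 * 2 ^ suc a , a ,
  λ m a≤m → forb-lower 1≤t 1≤a a≤m , forb-upper 1≤t (≤-trans 1≤a a≤m) d≤a
  where
  1≤t : 1 ≤ t
  1≤t = ≤-trans (s≤s z≤n) 2≤t
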